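{- Let $\mathfrak{D}=(S,s_0,K,\mathfrak{P})$ be a family of Markov chains and $M^{\mathfrak{D}}_\sim$ its quotient MDP under forgetting. Then \[\{(M^{\mathfrak{D}}_\sim)_{\sigma}\mid \sigma \text{ a consistent scheduler of } M^{\mathfrak{D}}_\sim\}=\{D_r\mid r\in\mathcal{R}^{\mathfrak{D}}\}\] (induced Markov chains being identified with $D_r$ via the map sending a path to the state $s$ of its last class $[s]_\sim$).
   Context: A family of Markov chains is $\mathfrak{D}=(S,s_0,K,\mathfrak{P})$ with finite state set $S$, initial state $s_0$, finite parameter set $K$ with domains $T_k\subseteq S$, and $\mathfrak{P}\colon S\to\mathit{Distr}(K)$. A realisation is $r\colon K\to S$ with $r(k)\in T_k$; $\mathcal{R}^{\mathfrak{D}}$ is the set of realisations; $D_r=(S,s_0,\mathfrak{P}(r))$ with $\mathfrak{P}(r)(s)(s')=\sum_{k:\,r(k)=s'}\mathfrak{P}(s)(k)$. The all-in-one MDP $M^{\mathfrak{D}}$ has states $S\times\mathcal{R}^{\mathfrak{D}}\cup\{s_0^{\mathfrak{D}}\}$, actions $a_r$ ($r\in\mathcal{R}^{\mathfrak{D}}$), $\mathcal{P}^{\mathfrak{D}}(s_0^{\mathfrak{D}},a_r)((s_0,r))=1$ and $\mathcal{P}^{\mathfrak{D}}((s,r),a_r)((s',r))=\mathfrak{P}(r)(s)(s')$. Forgetting is the equivalence $(s,r)\sim_f(s',r')$ iff $s=s'$, together with $s_0^{\mathfrak{D}}\sim_f(s_0,r)$ for all $r$. The quotient MDP is $M^{\mathfrak{D}}_\sim=(S^{\mathfrak{D}}_\sim,[s_0^{\mathfrak{D}}]_\sim,\{a_r\},\mathcal{P}^{\mathfrak{D}}_\sim)$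 with states the equivalence classes and $\mathcal{P}^{\mathfrak{D}}_\sim([s]_\sim,a_r)([s']_\sim)=\mathfrak{P}(r)(s)(s')$; every action $a_r$ is available in every state. A scheduler $\sigma$ (a map from finite paths to available actions; the induced Markov chain has finite paths as states) is $k$-consistent for $k\in K$ if for all finite paths $\pi,\pi'$, $\sigma(\pi)=a_r$ and $\sigma(\pi')=a_{r'}$ imply $r(k)=r'(k)$; it is consistent if it is $k$-consistent for all $k\in K$. -}

module Defs where

open import Level using (Level; _⊔_)
open import Algebra.Bundles using (CommutativeSemiring)
open import Data.Nat using (ℕ)
open import Data.Fin using (Fin; _≟_)
open import Data.Fin.Subset using (Subset; _∈_)
open import Data.Product using (Σ; ∃; _×_; _,_)
open import Relation.Nullary using (does)
open import Data.Bool using (if_then_else_)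
open import Relation.Binary.PropositionalEquality using (_≡_)
import Algebra.Definitions.RawMonoid as RawMonoidDefs

-- Probabilities live in an arbitrary commutative semiring R
-- (the paper uses the reals, which are not available in agda-stdlib).
module _ {c ℓ : Level} (R : CommutativeSemiring c ℓ) where
  open CommutativeSemiring R

  ∑ : ∀ {m} → (Fin m → Carrier) → Carrier
  ∑ f = RawMonoidDefs.sum +-rawMonoid f

  -- A family of Markov chains 𝔇 = (S, s₀, K, 𝔓) with S = Fin n, K = Fin m,
  -- domains T k ⊆ S and 𝔓 : S → Distr(K).
  record Family : Set (c ⊔ ℓ) where
    field
      n    : ℕ
      s₀   : Fin n
      m    : ℕ
      T    : Fin m → Subset n
      𝔓    : Fin n → Fin m → Carrier
      𝔓-distr : ∀ s → ∑ (𝔓 s) ≈ 1#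

  module _ (𝔇 : Family) where
    open Family 𝔇

    record Realisation : Set where
      constructor realisation
      field
        fun   : Fin m → Fin n
        valid : ∀ k → fun k ∈ T k
    open Realisation public

    𝔓[_] : Realisation → Fin n → Fin n → Carrier
    𝔓[ r ] s s' = ∑ (λ k → if does (fun r k ≟ s') then 𝔓 s k else 0#)

    -- The all-in-one MDP M^𝔇: states S × ℛ ∪ {s₀^𝔇}.
    data AIOState : Set where
      init : AIOState
      ⟨_,_⟩ : Fin n → Realisation → AIOState

    -- Forgetting: (s,r) ∼ (s',r') iff s = s', and s₀^𝔇 ∼ (s₀,r).
    -- Each class [x]∼ contains exactly one ⟨ s , _ ⟩-"S-component", so the
    -- classes are represented by the states of S via classOf.
    QState : Set
    QState = Fin n

    classOf : AIOState → QState
    classOf init      = s₀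
    classOf ⟨ s , _ ⟩ = s

    -- Quotient MDP M^𝔇_∼: initial state [s₀^𝔇]∼, every action a_r available
    -- everywhere, 𝒫_∼([s],a_r)([s']) = 𝔓(r)(s)(s').
    q-init : QState
    q-init = classOf init

    𝒫∼ : QState → Realisation → QState → Carrier
    𝒫∼ s r s' = 𝔓[ r ] s s'

    -- Finite paths of M^𝔇_∼ : [s₀^𝔇]∼ a₀ q₁ a₁ q₂ … (as snoc lists).
    data Path : Set where
      start : Path
      _▸_   : Path → Realisation × QState → Path

    last : Path → QState
    last start         = q-init
    last (_ ▸ (_ , q)) = q

    -- Schedulers: finite paths ↦ actions a_r (identified with r).
    Scheduler : Set
    Scheduler = Path → Realisation

    KConsistent : Scheduler → Fin m → Set
    KConsistent σ k = ∀ π π' → fun (σ π) k ≡ fun (σ π') k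

    Consistent : Scheduler → Set
    Consistent σ = ∀ k → KConsistent σ k

    -- Induced Markov chain (M^𝔇_∼)_σ: states are finite paths, initial state
    -- start; from π the only successors are π ▸ (σ π , q'), reached with
    -- probability 𝒫∼(last π, σ π)(q'); all other transitions have probability 0.
    inducedStep : Scheduler → Path → QState → Carrier
    inducedStep σ π q' = 𝒫∼ (last π) (σ π) q'

    -- (M^𝔇_∼)_σ is identified with D_r via π ↦ last π: initial states match and
    -- the transition from π to its (unique) successor with last state s' has
    -- probability 𝔓(r)(last π)(s').
    IdentifiedWith : Scheduler → Realisation → Set ℓ
    IdentifiedWith σ r =
      (last start ≡ s₀) × (∀ π s' → inducedStep σ π s' ≈ 𝔓[ r ] (last π) s')

module Submission where

-- The transition matrix 𝔓[ r ] of D_r depends only on the parameter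
-- assignment fun r : K → S, not on the proof that it respects the domains
-- T_k (realisation-matrix-cong).  A scheduler σ therefore induces D_r as soon
-- as every action it chooses assigns the same values as r to all parameters
-- (identified-if-agrees): the induced step from a path π is 𝔓[ σ π ] applied
-- to the last state of π.
--
-- (⊆) A consistent scheduler chooses, at every path, actions agreeing on each
--     parameter k with its choice at the empty path, so it induces D_r for
--     r = σ start.
-- (⊇) The scheduler constantly choosing a_r is trivially consistent
--     (constant-consistent) and induces D_r.

open import Defs
open import Level using (Level)
open import Algebra.Bundles using (CommutativeSemiring)
open import Data.Bool using (if_then_else_)
open import Data.Fin using (Fin; _≟_)
open import Data.Product using (Σ; _×_; _,_)
open import Relation.Nullary using (does)
open import Relation.Binary.PropositionalEquality using (_≡_; refl; cong)
import Algebra.Properties.Monoid.Sum as MonoidSum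

module _ {c ℓ : Level} (R : CommutativeSemiring c ℓ) (𝔇 : Family R) where
  open CommutativeSemiring R using (0#; reflexive; +-monoid)
  open Family 𝔇 using (𝔓)
  open MonoidSum +-monoid using (sum-cong-≗)

  realisation-matrix-cong : (r r' : Realisation R 𝔇) →
    (∀ k → fun r k ≡ fun r' k) →
    ∀ s s' → 𝔓[_] R 𝔇 r s s' ≡ 𝔓[_] R 𝔇 r' s s'
  realisation-matrix-cong r r' same s s' =
    sum-cong-≗ λ k → cong (λ t → if does (t ≟ s') then 𝔓 s k else 0#) (same k)

  identified-if-agrees : (σ : Scheduler R 𝔇) (r : Realisation R 𝔇) →
    (∀ π k → fun (σ π) k ≡ fun r k) →
    IdentifiedWith R 𝔇 σ r
  identified-if-agrees σ r agrees =
    refl , λ π s' → reflexive (realisation-matrix-cong (σ π) r (agrees π) (last R 𝔇 π) s')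

  constant : Realisation R 𝔇 → Scheduler R 𝔇
  constant r _ = r

  constant-consistent : (r : Realisation R 𝔇) → Consistent R 𝔇 (constant r)
  constant-consistent r k π π' = refl

mainTheorem3 : {c ℓ : Level} (R : CommutativeSemiring c ℓ) (𝔇 : Family R) →
    ((σ : Scheduler R 𝔇) → Consistent R 𝔇 σ →
       Σ (Realisation R 𝔇) (λ r → IdentifiedWith R 𝔇 σ r))
    × ((r : Realisation R 𝔇) →
       Σ (Scheduler R 𝔇) (λ σ → Consistent R 𝔇 σ × IdentifiedWith R 𝔇 σ r))
mainTheorem3 R 𝔇 = consistent⇒realisation , realisation⇒consistent
  where
  -- (⊆) every choice of σ agrees with its choice at the empty path.
  consistent⇒realisation : (σ : Scheduler R 𝔇) → Consistent R 𝔇 σ →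
    Σ (Realisation R 𝔇) (λ r → IdentifiedWith R 𝔇 σ r)
  consistent⇒realisation σ consistent =
    σ start , identified-if-agrees R 𝔇 σ (σ start) (λ π k → consistent k π start)

  realisation⇒consistent : (r : Realisation R 𝔇) →
    Σ (Scheduler R 𝔇) (λ σ → Consistent R 𝔇 σ × IdentifiedWith R 𝔇 σ r)
  realisation⇒consistent r =
    constant R 𝔇 r , constant-consistent R 𝔇 r ,
    identified-if-agrees R 𝔇 (constant R 𝔇 r) r (λ _ _ → refl)
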